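{- Let $S\subseteq\mathbb{Z}$ be a finite set satisfying $S=-S$ and ($\forall s,t\in\mathbb{N}\setminus S$, $s+t\notin S$), and let $m=\max(S)$. For all $U,V\subseteq[1;m-1]$, the formal power series $D_S^{U,V}(X,Y)$ is (the expansion of) a rational function in $\mathbb{Q}(X,Y)$, and this rational function is explicitly computable from $S$, $U$ and $V$.
   Context: $\mathbb{N}=\{0,1,\dots\}$, $[a;b]=\{k\in\mathbb{Z}:a\le k\le b\}$. An $S$-shadow is a finite set $D\subseteq\mathbb{N}$ with $0\in D$ such that the graph with vertex set $D$ and edges $\{i,j\}$ ($i,j\in D$, $i-j\in S$) is connected. For finite $D\subseteq\mathbb{N}$: $\mathrm{start}(D)=D\cap[1;m-1]$, $\mathrm{end}(D)=\{\max(D)-d:d\in D\}\cap[1;m-1]$. For $U,V\subseteq[1;m-1]$, $\mathcal{D}_S^{U,V}$ is the set of $S$-shadows $D$ with $\mathrm{start}(D)=U$ and $\mathrm{end}(D)=V$, and $D_S^{U,V}(X,Y)=\sum_{D\in\mathcal{D}_S^{U,V}}X^{|D|}Y^{\max(D)}$. -}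

module Defs where

open import Data.Bool using (Bool; true; false; _∧_)
open import Data.Nat using (ℕ; zero; suc; _≤_; _∸_; _≤ᵇ_)
import Data.Nat as ℕ
open import Data.Empty using (⊥)
open import Data.Integer using (ℤ; +_; -_; _-_; _*_; _+_)
import Data.Integer as ℤ
open import Data.List using (List; []; _∷_)
open import Data.List.Membership.Propositional using (_∈_)
open import Data.Vec using (Vec; []; _∷_)
open import Data.Fin using (Fin)
open import Data.Product using (Σ; _×_)
open import Data.Refinement using (Refinement)
open import Function.Bundles using (_↔_)
open import Relation.Binary.PropositionalEquality using (_≡_; _≢_)

-- Finite subsets of ℕ with maximum n are encoded as characteristic
-- vectors  D : Vec Bool (suc n)  indexed by 0 … n.

memb : ∀ {k} → ℕ → Vec Bool k → Bool
memb i       []      = false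
memb zero    (b ∷ v) = b
memb (suc i) (b ∷ v) = memb i v

card : ∀ {k} → Vec Bool k → ℕ
card []          = 0
card (true ∷ v)  = suc (card v)
card (false ∷ v) = card v

-- The graph on D with edges {i,j} when i - j ∈ S.
-- Reach S D j : the vertex j ∈ D is joined to the vertex 0 by a path.

data Reach {k} (S : List ℤ) (D : Vec Bool k) : ℕ → Set where
  here : Reach S D 0
  step : ∀ {i j} → Reach S D i → memb j D ≡ true →
         ((+ j) - (+ i)) ∈ S → Reach S D j

IsShadow : ∀ {n} → List ℤ → Vec Bool (suc n) → Set
IsShadow {n} S D =
  (memb 0 D ≡ true) × (memb n D ≡ true) ×
  (∀ i → memb i D ≡ true → Reach S D i)

StartIs : ∀ {n} → ℕ → Vec Bool (suc n) → (ℕ → Bool) → Set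
StartIs m D U = ∀ i → 1 ≤ i → i ≤ m ∸ 1 → memb i D ≡ U i

-- end(D) = V, end(D) = {max D - d : d ∈ D} ∩ [1;m-1]
EndIs : ∀ {n} → ℕ → Vec Bool (suc n) → (ℕ → Bool) → Set
EndIs {n} m D V = ∀ i → 1 ≤ i → i ≤ m ∸ 1 → V i ≡ ((i ≤ᵇ n) ∧ memb (n ∸ i) D)

SubsetRange : ℕ → (ℕ → Bool) → Set
SubsetRange m U = ∀ i → U i ≡ true → (1 ≤ i) × (i ≤ m ∸ 1)

-- The set of D ∈ 𝒟_S^{U,V} with |D| = k and max(D) = n
-- (the coefficient of X^k Y^n in D_S^{U,V}(X,Y) is its cardinality).
ShadowsUV : List ℤ → ℕ → (ℕ → Bool) → (ℕ → Bool) → ℕ → ℕ → Set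
ShadowsUV S m U V k n =
  Refinement (Vec Bool (suc n)) λ D →
    IsShadow S D × StartIs m D U × EndIs m D V × (card D ≡ k)

SymmetricSet : List ℤ → Set
SymmetricSet S = ∀ s → s ∈ S → (- s) ∈ S

ComplClosed : List ℤ → Set
ComplClosed S = ∀ (s t : ℕ) → ((+ s) ∈ S → ⊥) → ((+ t) ∈ S → ⊥) →
                ((+ (s ℕ.+ t)) ∈ S → ⊥)

IsMax : List ℤ → ℕ → Set
IsMax S m = ((+ m) ∈ S) × (∀ s → s ∈ S → s ℤ.≤ (+ m))

-- Bivariate polynomials with integer coefficients, as lists of rows:
-- coeff P a b is the coefficient of X^a Y^b.

Poly₂ : Set
Poly₂ = List (List ℤ)

coeff₁ : List ℤ → ℕ → ℤ
coeff₁ []       b       = + 0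
coeff₁ (x ∷ xs) zero    = x
coeff₁ (x ∷ xs) (suc b) = coeff₁ xs b

coeff : Poly₂ → ℕ → ℕ → ℤ
coeff []       a       b = + 0
coeff (r ∷ rs) zero    b = coeff₁ r b
coeff (r ∷ rs) (suc a) b = coeff rs a b

∑≤ : ℕ → (ℕ → ℤ) → ℤ
∑≤ zero    f = f 0
∑≤ (suc k) f = ∑≤ k f + f (suc k)

-- The power series with coefficients c (X^k Y^n ↦ c k n) is the
-- expansion of P / Q:  Q(0,0) ≠ 0 and Q · F = P in ℤ[[X,Y]].
IsExpansionOf : (ℕ → ℕ → ℕ) → Poly₂ → Poly₂ → Set
IsExpansionOf c P Q =
  (coeff Q 0 0 ≢ + 0) ×
  (∀ k n → ∑≤ k (λ a → ∑≤ n (λ b → coeff Q a b * (+ c (k ∸ a) (n ∸ b))))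
           ≡ coeff P k n)

SeriesIsRational : List ℤ → ℕ → (ℕ → Bool) → (ℕ → Bool) → Poly₂ → Poly₂ → Set
SeriesIsRational S m U V P Q =
  Σ (ℕ → ℕ → ℕ) λ c →
    (∀ k n → Fin (c k n) ↔ ShadowsUV S m U V k n) × IsExpansionOf c P Q

-- When 0, n ∈ D, D is an S-shadow iff every j ∈ [1;n] is crossed by an
-- edge u < j ≤ u + d with u, u + d ∈ D and d ∈ S: a path from 0 to n crosses every j, and conversely a
-- crossing edge of j, together with S = −S and the closure of ℕ ∖ S under addition, yields an edge into j
-- from below or from above. Since d ≤ m, these conditions and start(D) = U, end(D) = V are recognised by a
-- finite automaton reading D through a window of bounded width. For a finite automaton, the series
-- counting accepted words by number of 1s (X) and length (Y) satisfies, together with the series of the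
-- individual states, a linear system G = v + Y·A(X)·G; fraction-free Gaussian elimination solves it with
-- polynomial data and a denominator of constant term 1.

module Submission where

open import Defs
open import Data.Bool using (Bool)
open import Data.Nat using (ℕ)
open import Data.Integer using (ℤ)
open import Data.List using (List)
open import Data.Product using (Σ; _×_; proj₁; proj₂)

open import Algebra using (CommutativeRing)
open import Algebra.Structures using (IsCommutativeRing)
import Algebra.Construct.Pointwise as Pointwise
import Algebra.Properties.CommutativeSemigroup as CommutativeSemigroupProperties
import Algebra.Properties.Semiring.Sum as Sum
open import Data.Bool using (true; false; T; _∧_; if_then_else_)
import Data.Bool.Properties as Bool
open import Data.Empty using (⊥-elim; ⊥-elim-irr)
open import Data.Fin as Fin using (Fin; zero; suc)
open import Data.Fin.Properties using (+↔⊎; 2↔Bool; *↔×)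
open import Data.Integer as ℤ using (+_)
import Data.Integer.Properties as ℤ
open import Data.Irrelevant as Irrelevant using ([_])
open import Data.List using (applyUpTo)
open import Data.List.Membership.Propositional using (_∈_)
open import Data.List.Membership.DecPropositional ℤ._≟_ using (_∈?_)
open import Data.Maybe using (Maybe; just; nothing; is-just; fromMaybe)
open import Data.Nat as ℕ using (zero; suc; _∸_; _^_; _≤_; _<_; _≤?_; _<?_; _≤ᵇ_; _≡ᵇ_; z≤n; s≤s)
import Data.Nat.Properties as ℕ
open import Data.Nat.Induction using (<-rec)
open import Data.Product using (_,_; uncurry)
open import Data.Product.Function.NonDependent.Propositional using (_×-↔_; _×-⇔_)
open import Data.Refinement using (Refinement; _,_)
open import Data.Sum using (_⊎_; inj₁; inj₂)
open import Data.Sum.Function.Propositional using (_⊎-↔_)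
open import Data.Unit using (⊤; tt)
open import Data.Vec using (Vec; []; _∷_; replicate; uncons)
open import Function using (_∘_; case_of_)
open import Function.Bundles using (_↔_; _⇔_; mk↔ₛ′; mk⇔; Inverse; Equivalence)
open import Function.Construct.Composition using (_⇔-∘_)
open import Function.Construct.Identity using (⇔-id)
open import Function.Construct.Symmetry using (⇔-sym)
open import Function.Properties.Inverse using (↔-trans; ↔-sym)
open import Level using (0ℓ; _⊔_) renaming (suc to lsuc)
open import Relation.Nullary using (Dec; yes; no; does; _×-dec_; _→-dec_; contradiction)
open import Relation.Nullary.Decidable using (isYes; toWitness; fromWitness)
open import Relation.Binary.PropositionalEquality using (_≡_; _≢_; refl; cong; cong₂; sym; trans; subst)
open import Relation.Binary.PropositionalEquality.Properties using (module ≡-Reasoning)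

module FormalPowerSeries {c ℓ} (R : CommutativeRing c ℓ) where
  open CommutativeRing R hiding (zero)
    renaming (refl to ≈-refl; sym to ≈-sym; trans to ≈-trans; reflexive to ≈-reflexive)
  open CommutativeSemigroupProperties +-commutativeSemigroup using (interchange)
  open import Relation.Binary.Reasoning.Setoid setoid

  Series : Set c
  Series = ℕ → Carrier

  infix 4 _≋_
  _≋_ : Series → Series → Set ℓ
  f ≋ g = ∀ n → f n ≈ g n

  sumUpTo : ℕ → (ℕ → Carrier) → Carrier
  sumUpTo zero    f = f 0
  sumUpTo (suc n) f = sumUpTo n f + f (suc n)

  sumUpTo-cong : ∀ n {f g} → (∀ i → i ≤ n → f i ≈ g i) → sumUpTo n f ≈ sumUpTo n g
  sumUpTo-cong zero    f≈g = f≈g 0 z≤n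
  sumUpTo-cong (suc n) f≈g =
    +-cong (sumUpTo-cong n λ i i≤n → f≈g i (ℕ.m≤n⇒m≤1+n i≤n)) (f≈g (suc n) ℕ.≤-refl)

  sumUpTo-suc : ∀ n f → sumUpTo (suc n) f ≈ f 0 + sumUpTo n (λ i → f (suc i))
  sumUpTo-suc zero    f = ≈-refl
  sumUpTo-suc (suc n) f = ≈-trans (+-congʳ (sumUpTo-suc n f)) (+-assoc _ _ _)

  sumUpTo-+ : ∀ n f g → sumUpTo n (λ i → f i + g i) ≈ sumUpTo n f + sumUpTo n g
  sumUpTo-+ zero    f g = ≈-refl
  sumUpTo-+ (suc n) f g = ≈-trans (+-congʳ (sumUpTo-+ n f g)) (interchange _ _ _ _)

  *-distribˡ-sumUpTo : ∀ n a f → a * sumUpTo n f ≈ sumUpTo n (λ i → a * f i)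
  *-distribˡ-sumUpTo zero    a f = ≈-refl
  *-distribˡ-sumUpTo (suc n) a f = ≈-trans (distribˡ a _ _) (+-congʳ (*-distribˡ-sumUpTo n a f))

  sumUpTo-zero : ∀ n {f} → (∀ i → i ≤ n → f i ≈ 0#) → sumUpTo n f ≈ 0#
  sumUpTo-zero zero    f≈0 = f≈0 0 z≤n
  sumUpTo-zero (suc n) f≈0 =
    ≈-trans (+-cong (sumUpTo-zero n λ i i≤n → f≈0 i (ℕ.m≤n⇒m≤1+n i≤n)) (f≈0 (suc n) ℕ.≤-refl)) (+-identityˡ 0#)

  sumUpTo-reverse : ∀ n f → sumUpTo n f ≈ sumUpTo n (λ i → f (n ∸ i))
  sumUpTo-reverse zero    f = ≈-refl
  sumUpTo-reverse (suc n) f = begin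
    sumUpTo n f + f (suc n)                    ≈⟨ +-congʳ (sumUpTo-reverse n f) ⟩
    sumUpTo n (λ i → f (n ∸ i)) + f (suc n)    ≈⟨ +-comm _ _ ⟩
    f (suc n) + sumUpTo n (λ i → f (n ∸ i))    ≈⟨ sumUpTo-suc n (λ i → f (suc n ∸ i)) ⟨
    sumUpTo (suc n) (λ i → f (suc n ∸ i))      ∎

  infixl 6 _+ₛ_
  infixl 7 _*ₛ_

  _+ₛ_ : Series → Series → Series
  (f +ₛ g) n = f n + g n

  -ₛ_ : Series → Series
  (-ₛ f) n = - f n

  0ₛ : Series
  0ₛ _ = 0#

  _*ₛ_ : Series → Series → Series
  (f *ₛ g) n = sumUpTo n (λ i → f i * g (n ∸ i))

  ι : Carrier → Series
  ι a zero    = a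
  ι a (suc _) = 0#

  1ₛ : Series
  1ₛ = ι 1#

  𝕩 : Series
  𝕩 zero    = 0#
  𝕩 (suc n) = 1ₛ n

  tail : Series → Series
  tail f n = f (suc n)

  *ₛ-suc : ∀ f g n → (f *ₛ g) (suc n) ≈ f 0 * g (suc n) + (tail f *ₛ g) n
  *ₛ-suc f g n = sumUpTo-suc n (λ i → f i * g (suc n ∸ i))

  *ₛ-cong : ∀ {f f′ g g′} → f ≋ f′ → g ≋ g′ → f *ₛ g ≋ f′ *ₛ g′
  *ₛ-cong f≋f′ g≋g′ n = sumUpTo-cong n λ i _ → *-cong (f≋f′ i) (g≋g′ (n ∸ i))

  *ₛ-comm : ∀ f g → f *ₛ g ≋ g *ₛ f
  *ₛ-comm f g n = begin
    sumUpTo n (λ i → f i * g (n ∸ i))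
      ≈⟨ sumUpTo-reverse n _ ⟩
    sumUpTo n (λ i → f (n ∸ i) * g (n ∸ (n ∸ i)))
      ≈⟨ sumUpTo-cong n (λ i i≤n → ≈-trans (*-comm _ _) (*-congʳ (≈-reflexive (cong g (ℕ.m∸[m∸n]≡n i≤n))))) ⟩
    sumUpTo n (λ i → g i * f (n ∸ i)) ∎

  *ₛ-distribʳ : ∀ f g h → (f +ₛ g) *ₛ h ≋ f *ₛ h +ₛ g *ₛ h
  *ₛ-distribʳ f g h n = ≈-trans (sumUpTo-cong n λ i _ → distribʳ _ _ _) (sumUpTo-+ n _ _)

  ι-*ₛ : ∀ a f → ι a *ₛ f ≋ λ n → a * f n
  ι-*ₛ a f zero    = ≈-refl
  ι-*ₛ a f (suc n) = begin
    (ι a *ₛ f) (suc n)            ≈⟨ *ₛ-suc (ι a) f n ⟩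
    a * f (suc n) + (0ₛ *ₛ f) n   ≈⟨ +-congˡ (sumUpTo-zero n λ _ _ → zeroˡ _) ⟩
    a * f (suc n) + 0#            ≈⟨ +-identityʳ _ ⟩
    a * f (suc n)                 ∎

  𝕩-*ₛ-zero : ∀ f → (𝕩 *ₛ f) 0 ≈ 0#
  𝕩-*ₛ-zero f = zeroˡ (f 0)

  𝕩-*ₛ-suc : ∀ f n → (𝕩 *ₛ f) (suc n) ≈ f n
  𝕩-*ₛ-suc f n = begin
    (𝕩 *ₛ f) (suc n)               ≈⟨ *ₛ-suc 𝕩 f n ⟩
    0# * f (suc n) + (1ₛ *ₛ f) n   ≈⟨ +-cong (zeroˡ _) (ι-*ₛ 1# f n) ⟩
    0# + 1# * f n                  ≈⟨ +-identityˡ _ ⟩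
    1# * f n                       ≈⟨ *-identityˡ _ ⟩
    f n                            ∎

  *ₛ-identityˡ : ∀ f → 1ₛ *ₛ f ≋ f
  *ₛ-identityˡ f n = ≈-trans (ι-*ₛ 1# f n) (*-identityˡ (f n))

  *ₛ-assoc : ∀ f g h → (f *ₛ g) *ₛ h ≋ f *ₛ (g *ₛ h)
  *ₛ-assoc f g h zero    = *-assoc _ _ _
  *ₛ-assoc f g h (suc n) = begin
    ((f *ₛ g) *ₛ h) (suc n)
      ≈⟨ *ₛ-suc (f *ₛ g) h n ⟩
    (f 0 * g 0) * h (suc n) + (tail (f *ₛ g) *ₛ h) n
      ≈⟨ +-congˡ (*ₛ-cong {g = h} (*ₛ-suc f g) (λ _ → ≈-refl) n) ⟩
    (f 0 * g 0) * h (suc n) + (((λ i → f 0 * g (suc i)) +ₛ tail f *ₛ g) *ₛ h) n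
      ≈⟨ +-congˡ (*ₛ-distribʳ _ _ h n) ⟩
    (f 0 * g 0) * h (suc n) + (((λ i → f 0 * g (suc i)) *ₛ h) n + ((tail f *ₛ g) *ₛ h) n)
      ≈⟨ +-congˡ (+-cong (≈-trans (sumUpTo-cong n λ _ _ → *-assoc _ _ _) (≈-sym (*-distribˡ-sumUpTo n _ _)))
                         (*ₛ-assoc (tail f) g h n)) ⟩
    (f 0 * g 0) * h (suc n) + (f 0 * (tail g *ₛ h) n + (tail f *ₛ (g *ₛ h)) n)
      ≈⟨ +-assoc _ _ _ ⟨
    ((f 0 * g 0) * h (suc n) + f 0 * (tail g *ₛ h) n) + (tail f *ₛ (g *ₛ h)) n
      ≈⟨ +-congʳ (≈-trans (+-congʳ (*-assoc _ _ _)) (≈-sym (distribˡ _ _ _))) ⟩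
    f 0 * (g 0 * h (suc n) + (tail g *ₛ h) n) + (tail f *ₛ (g *ₛ h)) n
      ≈⟨ +-congʳ (*-congˡ (*ₛ-suc g h n)) ⟨
    f 0 * (g *ₛ h) (suc n) + (tail f *ₛ (g *ₛ h)) n
      ≈⟨ *ₛ-suc f (g *ₛ h) n ⟨
    (f *ₛ (g *ₛ h)) (suc n) ∎

  series-isCommutativeRing : IsCommutativeRing _≋_ _+ₛ_ _*ₛ_ -ₛ_ 0ₛ 1ₛ
  series-isCommutativeRing = record
    { isRing = record
      { +-isAbelianGroup = Pointwise.isAbelianGroup ℕ +-isAbelianGroup
      ; *-cong           = *ₛ-cong
      ; *-assoc          = *ₛ-assoc
      ; *-identity       = *ₛ-identityˡ , λ f n → ≈-trans (*ₛ-comm f 1ₛ n) (*ₛ-identityˡ f n)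
      ; distrib          = (λ f g h n → ≈-trans (*ₛ-comm f (g +ₛ h) n)
                                       (≈-trans (*ₛ-distribʳ g h f n) (+-cong (*ₛ-comm g f n) (*ₛ-comm h f n))))
                         , (λ h f g → *ₛ-distribʳ f g h)
      }
    ; *-comm = *ₛ-comm
    }

  seriesRing : CommutativeRing c ℓ
  seriesRing = record { isCommutativeRing = series-isCommutativeRing }

module Elimination {c ℓ} (R : CommutativeRing c ℓ) where
  open CommutativeRing R hiding (zero)
    renaming (refl to ≈-refl; sym to ≈-sym; trans to ≈-trans; reflexive to ≈-reflexive)
  open import Algebra.Properties.Ring ring using (-‿distribˡ-*)
  open import Algebra.Properties.Semiring.Sum semiring using (sum; sum-cong-≋; ∑-distrib-+; *-distribˡ-sum)
  open CommutativeSemigroupProperties *-commutativeSemigroup using (x∙yz≈y∙xz)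
  open import Relation.Binary.Reasoning.Setoid setoid

  +-cancel-middle : ∀ a b c → (a + (b + c)) - b ≈ a + c
  +-cancel-middle a b c = begin
    (a + (b + c)) - b   ≈⟨ +-congʳ (+-congˡ (+-comm b c)) ⟩
    (a + (c + b)) - b   ≈⟨ +-congʳ (+-assoc a c b) ⟨
    ((a + c) + b) - b   ≈⟨ +-assoc _ _ _ ⟩
    (a + c) + (b - b)   ≈⟨ +-congˡ (-‿inverseʳ b) ⟩
    (a + c) + 0#        ≈⟨ +-identityʳ _ ⟩
    a + c               ∎

  substitute : ∀ {q g v σ y a t ρ} → q * g ≈ v + σ → y ≈ a + (t * g + ρ) →
               q * y ≈ (q * a + t * v) + (q * ρ + t * σ)
  substitute {q} {g} {v} {σ} {y} {a} {t} {ρ} qg≈v+σ y≈ = begin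
    q * y                                ≈⟨ *-congˡ y≈ ⟩
    q * (a + (t * g + ρ))                ≈⟨ ≈-trans (distribˡ _ _ _) (+-congˡ (distribˡ _ _ _)) ⟩
    q * a + (q * (t * g) + q * ρ)        ≈⟨ +-congˡ (+-congʳ (≈-trans (x∙yz≈y∙xz q t g) (*-congˡ qg≈v+σ))) ⟩
    q * a + (t * (v + σ) + q * ρ)        ≈⟨ +-congˡ (+-congʳ (distribˡ _ _ _)) ⟩
    q * a + ((t * v + t * σ) + q * ρ)    ≈⟨ +-congˡ (+-assoc _ _ _) ⟩
    q * a + (t * v + (t * σ + q * ρ))    ≈⟨ +-assoc _ _ _ ⟨
    (q * a + t * v) + (t * σ + q * ρ)    ≈⟨ +-congˡ (+-comm _ _) ⟩
    (q * a + t * v) + (q * ρ + t * σ)    ∎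

  sum-combine : ∀ {N} q b (x y g : Fin N → Carrier) →
                sum (λ i → (q * x i + b * y i) * g i) ≈ q * sum (λ i → x i * g i) + b * sum (λ i → y i * g i)
  sum-combine {N} q b x y g = begin
    sum (λ i → (q * x i + b * y i) * g i)
      ≈⟨ sum-cong-≋ {N} (λ i → ≈-trans (distribʳ (g i) _ _) (+-cong (*-assoc q (x i) (g i)) (*-assoc b (y i) (g i)))) ⟩
    sum (λ i → q * (x i * g i) + b * (y i * g i))
      ≈⟨ ∑-distrib-+ {N} (λ i → q * (x i * g i)) _ ⟩
    sum (λ i → q * (x i * g i)) + sum (λ i → b * (y i * g i))
      ≈⟨ +-cong (*-distribˡ-sum {N} q _) (*-distribˡ-sum {N} b _) ⟨
    q * sum (λ i → x i * g i) + b * sum (λ i → y i * g i) ∎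

  record PolynomialStructure p : Set (c ⊔ lsuc p) where
    field
      IsPolynomial     : Carrier → Set p
      ConstantTermZero : Carrier → Set p
      ConstantTermOne  : Carrier → Set p
      poly-+           : ∀ {a b} → IsPolynomial a → IsPolynomial b → IsPolynomial (a + b)
      poly-*           : ∀ {a b} → IsPolynomial a → IsPolynomial b → IsPolynomial (a * b)
      poly-neg         : ∀ {a} → IsPolynomial a → IsPolynomial (- a)
      zero-+           : ∀ {a b} → ConstantTermZero a → ConstantTermZero b → ConstantTermZero (a + b)
      zero-*ˡ          : ∀ {a b} → ConstantTermZero b → ConstantTermZero (a * b)
      one-*            : ∀ {a b} → ConstantTermOne a → ConstantTermOne b → ConstantTermOne (a * b)
      one-minus-zero   : ∀ {a b} → ConstantTermOne a → ConstantTermZero b → ConstantTermOne (a - b)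

  module _ {p} (𝒫 : PolynomialStructure p) where
    open PolynomialStructure 𝒫

    IsRational : Carrier → Set (c ⊔ ℓ ⊔ p)
    IsRational x = Σ (Carrier × Carrier) λ (q , r) →
      IsPolynomial q × IsPolynomial r × ConstantTermOne q × q * x ≈ r

    record LinearSystem (N : ℕ) (x : Carrier) : Set (c ⊔ ℓ ⊔ p) where
      field
        unknown          : Fin N → Carrier
        diagonal         : Carrier
        constant         : Fin N → Carrier
        coefficient      : Fin N → Fin N → Carrier
        equation         : ∀ s → diagonal * unknown s ≈ constant s + sum (λ t → coefficient s t * unknown t)
        scale            : Carrier
        offset           : Carrier
        weight           : Fin N → Carrier
        output           : scale * x ≈ offset + sum (λ t → weight t * unknown t)
        diagonal-poly    : IsPolynomial diagonal
        constant-poly    : ∀ s → IsPolynomial (constant s)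
        coefficient-poly : ∀ s t → IsPolynomial (coefficient s t)
        scale-poly       : IsPolynomial scale
        offset-poly      : IsPolynomial offset
        weight-poly      : ∀ t → IsPolynomial (weight t)
        diagonal-one     : ConstantTermOne diagonal
        coefficient-zero : ∀ s t → ConstantTermZero (coefficient s t)
        scale-one        : ConstantTermOne scale

    module Pivot {N x} (E : LinearSystem (ℕ.suc N) x) where
      open LinearSystem E public renaming
        (unknown to G; diagonal to q; constant to v; coefficient to A; scale to r; offset to u; weight to w)

      q₀ : Carrier
      q₀ = q - A zero zero

      q₀-poly : IsPolynomial q₀
      q₀-poly = poly-+ diagonal-poly (poly-neg (coefficient-poly zero zero))

      q₀-one : ConstantTermOne q₀
      q₀-one = one-minus-zero diagonal-one (coefficient-zero zero zero)

      σ₀ : Carrier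
      σ₀ = sum (λ t → A zero (suc t) * G (suc t))

      pivot : q₀ * G zero ≈ v zero + σ₀
      pivot = begin
        q₀ * G zero                                                     ≈⟨ distribʳ _ _ _ ⟩
        q * G zero + - A zero zero * G zero                             ≈⟨ +-congˡ (-‿distribˡ-* _ _) ⟨
        q * G zero - A zero zero * G zero                               ≈⟨ +-congʳ (equation zero) ⟩
        (v zero + (A zero zero * G zero + σ₀)) - A zero zero * G zero   ≈⟨ +-cancel-middle _ _ _ ⟩
        v zero + σ₀                                                     ∎

      eliminate : ∀ {y a b} (c : Fin N → Carrier) → y ≈ a + (b * G zero + sum (λ t → c t * G (suc t))) →
                  q₀ * y ≈ (q₀ * a + b * v zero) + sum (λ t → (q₀ * c t + b * A zero (suc t)) * G (suc t))
      eliminate {b = b} c y≈ = ≈-trans (substitute pivot y≈)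
        (+-congˡ (≈-sym (sum-combine q₀ b c (λ t → A zero (suc t)) (λ t → G (suc t)))))

    eliminateFirst : ∀ {N x} → LinearSystem (ℕ.suc N) x → LinearSystem N x
    eliminateFirst E = record
      { unknown          = λ s → G (suc s)
      ; diagonal         = q₀ * q
      ; constant         = λ s → q₀ * v (suc s) + A (suc s) zero * v zero
      ; coefficient      = λ s t → q₀ * A (suc s) (suc t) + A (suc s) zero * A zero (suc t)
      ; equation         = λ s → ≈-trans (*-assoc _ _ _) (eliminate (λ t → A (suc s) (suc t)) (equation (suc s)))
      ; scale            = q₀ * r
      ; offset           = q₀ * u + w zero * v zero
      ; weight           = λ t → q₀ * w (suc t) + w zero * A zero (suc t)
      ; output           = ≈-trans (*-assoc _ _ _) (eliminate (λ t → w (suc t)) output)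
      ; diagonal-poly    = poly-* q₀-poly diagonal-poly
      ; constant-poly    = λ s → poly-+ (poly-* q₀-poly (constant-poly (suc s)))
                                        (poly-* (coefficient-poly (suc s) zero) (constant-poly zero))
      ; coefficient-poly = λ s t → poly-+ (poly-* q₀-poly (coefficient-poly (suc s) (suc t)))
                                          (poly-* (coefficient-poly (suc s) zero) (coefficient-poly zero (suc t)))
      ; scale-poly       = poly-* q₀-poly scale-poly
      ; offset-poly      = poly-+ (poly-* q₀-poly offset-poly) (poly-* (weight-poly zero) (constant-poly zero))
      ; weight-poly      = λ t → poly-+ (poly-* q₀-poly (weight-poly (suc t)))
                                        (poly-* (weight-poly zero) (coefficient-poly zero (suc t)))
      ; diagonal-one     = one-* q₀-one diagonal-one
      ; coefficient-zero = λ s t → zero-+ (zero-*ˡ (coefficient-zero (suc s) (suc t)))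
                                          (zero-*ˡ (coefficient-zero zero (suc t)))
      ; scale-one        = one-* q₀-one scale-one
      }
      where open Pivot E

    solve : ∀ {N x} → LinearSystem N x → IsRational x
    solve {ℕ.zero}  E = (scale , offset) , scale-poly , offset-poly , scale-one , ≈-trans output (+-identityʳ offset)
      where open LinearSystem E
    solve {ℕ.suc N} E = solve (eliminateFirst E)

-- Bivariate integer series

module ℤ⟦Y⟧ = FormalPowerSeries ℤ.+-*-commutativeRing
module ℤ⟦X,Y⟧ = FormalPowerSeries ℤ⟦Y⟧.seriesRing

-- A bivariate series is a series in X with coefficients in ℤ⟦Y⟧: F k n is the coefficient of X^k Y^n.
Series₂ : Set
Series₂ = ℕ → ℕ → ℤ

open ℤ⟦X,Y⟧ using (_+ₛ_; -ₛ_; _*ₛ_; 0ₛ; 1ₛ; ι; 𝕩)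

X Y : Series₂
X = 𝕩
Y = ι ℤ⟦Y⟧.𝕩

ι₂ : ℤ → Series₂
ι₂ c = ι (ℤ⟦Y⟧.ι c)

ι₂-suc : ∀ c k n → ι₂ c k (suc n) ≡ + 0
ι₂-suc c zero    n = refl
ι₂-suc c (suc k) n = refl

ι₂-* : ∀ c F k n → (ι₂ c *ₛ F) k n ≡ c ℤ.* F k n
ι₂-* c F k n = trans (ℤ⟦X,Y⟧.ι-*ₛ (ℤ⟦Y⟧.ι c) F k n) (ℤ⟦Y⟧.ι-*ₛ c (F k) n)

X-*-zero : ∀ F n → (X *ₛ F) 0 n ≡ + 0
X-*-zero = ℤ⟦X,Y⟧.𝕩-*ₛ-zero

X-*-suc : ∀ F k n → (X *ₛ F) (suc k) n ≡ F k n
X-*-suc = ℤ⟦X,Y⟧.𝕩-*ₛ-suc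

Y-*-zero : ∀ F k → (Y *ₛ F) k 0 ≡ + 0
Y-*-zero F k = trans (ℤ⟦X,Y⟧.ι-*ₛ ℤ⟦Y⟧.𝕩 F k 0) (ℤ⟦Y⟧.𝕩-*ₛ-zero (F k))

Y-*-suc : ∀ F k n → (Y *ₛ F) k (suc n) ≡ F k n
Y-*-suc F k n = trans (ℤ⟦X,Y⟧.ι-*ₛ ℤ⟦Y⟧.𝕩 F k (suc n)) (ℤ⟦Y⟧.𝕩-*ₛ-suc (F k) n)

sumUpTo-coeff : ∀ k (F : Series₂) n → ℤ⟦X,Y⟧.sumUpTo k F n ≡ ℤ⟦Y⟧.sumUpTo k (λ a → F a n)
sumUpTo-coeff zero    F n = refl
sumUpTo-coeff (suc k) F n = cong (ℤ._+ F (suc k) n) (sumUpTo-coeff k F n)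

sumUpTo≡∑≤ : ∀ n f → ℤ⟦Y⟧.sumUpTo n f ≡ ∑≤ n f
sumUpTo≡∑≤ zero    f = refl
sumUpTo≡∑≤ (suc n) f = cong (ℤ._+ f (suc n)) (sumUpTo≡∑≤ n f)

∑≤-cong : ∀ k {f g} → (∀ a → f a ≡ g a) → ∑≤ k f ≡ ∑≤ k g
∑≤-cong zero    f≡g = f≡g 0
∑≤-cong (suc k) f≡g = cong₂ ℤ._+_ (∑≤-cong k f≡g) (f≡g (suc k))

*ₛ-coeff : ∀ F G k n → (F *ₛ G) k n ≡ ∑≤ k (λ a → ∑≤ n (λ b → F a b ℤ.* G (k ∸ a) (n ∸ b)))
*ₛ-coeff F G k n = begin
  (F *ₛ G) k n                                                                ≡⟨ sumUpTo-coeff k _ n ⟩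
  ℤ⟦Y⟧.sumUpTo k (λ a → ℤ⟦Y⟧.sumUpTo n (λ b → F a b ℤ.* G (k ∸ a) (n ∸ b)))  ≡⟨ sumUpTo≡∑≤ k _ ⟩
  ∑≤ k (λ a → ℤ⟦Y⟧.sumUpTo n (λ b → F a b ℤ.* G (k ∸ a) (n ∸ b)))
    ≡⟨ ∑≤-cong k (λ a → sumUpTo≡∑≤ n _) ⟩
  ∑≤ k (λ a → ∑≤ n (λ b → F a b ℤ.* G (k ∸ a) (n ∸ b)))                      ∎
  where open ≡-Reasoning

module ∑ℤ = Sum (CommutativeRing.semiring ℤ.+-*-commutativeRing)
module ∑₂ = Sum (CommutativeRing.semiring ℤ⟦X,Y⟧.seriesRing)
open ∑ℤ using (sum)

∑₂-coeff : ∀ {N} (F : Fin N → Series₂) k n → ∑₂.sum F k n ≡ sum (λ t → F t k n)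
∑₂-coeff {zero}  F k n = refl
∑₂-coeff {suc N} F k n = cong (λ x → F zero k n ℤ.+ x) (∑₂-coeff (λ t → F (suc t)) k n)

DegreeBelow : ℕ → Series₂ → Set
DegreeBelow B F = ∀ a b → B ≤ a ℕ.+ b → F a b ≡ + 0

IsPolynomial : Series₂ → Set
IsPolynomial F = Σ ℕ λ B → DegreeBelow B F

poly-+ : ∀ {F G} → IsPolynomial F → IsPolynomial G → IsPolynomial (F +ₛ G)
poly-+ (B₁ , F≡0) (B₂ , G≡0) = B₁ ℕ.+ B₂ , λ a b B≤ →
  cong₂ ℤ._+_ (F≡0 a b (ℕ.≤-trans (ℕ.m≤m+n B₁ B₂) B≤)) (G≡0 a b (ℕ.≤-trans (ℕ.m≤n+m B₂ B₁) B≤))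

poly-neg : ∀ {F} → IsPolynomial F → IsPolynomial (-ₛ F)
poly-neg (B , F≡0) = B , λ a b B≤ → cong ℤ.-_ (F≡0 a b B≤)

degree-split : ∀ {B₁ B₂ a b i j} → i ≤ a → j ≤ b → B₁ ℕ.+ B₂ ≤ a ℕ.+ b →
               B₁ ≤ i ℕ.+ j ⊎ B₂ ≤ (a ∸ i) ℕ.+ (b ∸ j)
degree-split {B₁} {B₂} {a} {b} {i} {j} i≤a j≤b B≤ with B₁ ≤? i ℕ.+ j
... | yes B₁≤ = inj₁ B₁≤
... | no  B₁≰ = inj₂ (ℕ.+-cancelʳ-≤ (i ℕ.+ j) B₂ ((a ∸ i) ℕ.+ (b ∸ j)) (begin
  B₂ ℕ.+ (i ℕ.+ j)                      ≤⟨ ℕ.+-monoʳ-≤ B₂ (ℕ.<⇒≤ (ℕ.≰⇒> B₁≰)) ⟩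
  B₂ ℕ.+ B₁                             ≡⟨ ℕ.+-comm B₂ B₁ ⟩
  B₁ ℕ.+ B₂                             ≤⟨ B≤ ⟩
  a ℕ.+ b                               ≡⟨ cong₂ ℕ._+_ (ℕ.m∸n+n≡m i≤a) (ℕ.m∸n+n≡m j≤b) ⟨
  ((a ∸ i) ℕ.+ i) ℕ.+ ((b ∸ j) ℕ.+ j)   ≡⟨ interchange (a ∸ i) i (b ∸ j) j ⟩
  ((a ∸ i) ℕ.+ (b ∸ j)) ℕ.+ (i ℕ.+ j)   ∎))
  where
  open ℕ.≤-Reasoning
  open CommutativeSemigroupProperties ℕ.+-commutativeSemigroup using (interchange)

poly-* : ∀ {F G} → IsPolynomial F → IsPolynomial G → IsPolynomial (F *ₛ G)
poly-* {F} {G} (B₁ , F≡0) (B₂ , G≡0) = B₁ ℕ.+ B₂ , λ a b B≤ →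
  trans (sumUpTo-coeff a _ b)
        (ℤ⟦Y⟧.sumUpTo-zero a λ i i≤a → ℤ⟦Y⟧.sumUpTo-zero b λ j j≤b → term (degree-split i≤a j≤b B≤))
  where
  term : ∀ {a b i j} → B₁ ≤ i ℕ.+ j ⊎ B₂ ≤ (a ∸ i) ℕ.+ (b ∸ j) → F i j ℤ.* G (a ∸ i) (b ∸ j) ≡ + 0
  term {a} {b} {i} {j} (inj₁ B₁≤) = cong (ℤ._* G (a ∸ i) (b ∸ j)) (F≡0 i j B₁≤)
  term {a} {b} {i} {j} (inj₂ B₂≤) = trans (cong (F i j ℤ.*_) (G≡0 (a ∸ i) (b ∸ j) B₂≤)) (ℤ.*-zeroʳ (F i j))

0ₛ-poly : IsPolynomial 0ₛ
0ₛ-poly = 0 , λ _ _ _ → refl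

ι₂-poly : ∀ c → IsPolynomial (ι₂ c)
ι₂-poly c = 1 , λ where
  zero    (suc b) _ → refl
  (suc a) b       _ → refl

X-poly : IsPolynomial X
X-poly = 2 , λ where
  zero          b       _        → refl
  (suc zero)    zero    (s≤s ())
  (suc zero)    (suc b) _        → refl
  (suc (suc a)) b       _        → refl

Y-poly : IsPolynomial Y
Y-poly = 2 , λ where
  zero    zero          ()
  zero    (suc zero)    (s≤s ())
  zero    (suc (suc b)) _        → refl
  (suc a) b             _        → refl

polynomialStructure : Elimination.PolynomialStructure ℤ⟦X,Y⟧.seriesRing 0ℓ
polynomialStructure = record
  { IsPolynomial     = IsPolynomial
  ; ConstantTermZero = λ F → F 0 0 ≡ + 0
  ; ConstantTermOne  = λ F → F 0 0 ≡ + 1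
  ; poly-+           = poly-+
  ; poly-*           = poly-*
  ; poly-neg         = poly-neg
  ; zero-+           = cong₂ ℤ._+_
  ; zero-*ˡ          = λ {F} G₀₀≡0 → trans (cong (F 0 0 ℤ.*_) G₀₀≡0) (ℤ.*-zeroʳ (F 0 0))
  ; one-*            = cong₂ ℤ._*_
  ; one-minus-zero   = cong₂ ℤ._-_
  }

coeff₁-applyUpTo : ∀ w (g : ℕ → ℤ) → (∀ b → w ≤ b → g b ≡ + 0) → ∀ b → coeff₁ (applyUpTo g w) b ≡ g b
coeff₁-applyUpTo zero    g g≡0 b       = sym (g≡0 b z≤n)
coeff₁-applyUpTo (suc w) g g≡0 zero    = refl
coeff₁-applyUpTo (suc w) g g≡0 (suc b) = coeff₁-applyUpTo w (g ∘ suc) (λ b w≤b → g≡0 (suc b) (s≤s w≤b)) b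

coeff-applyUpTo : ∀ h w (F : Series₂) → (∀ a b → h ≤ a → F a b ≡ + 0) → (∀ a b → w ≤ b → F a b ≡ + 0) →
                  ∀ a b → coeff (applyUpTo (λ a → applyUpTo (F a) w) h) a b ≡ F a b
coeff-applyUpTo zero    w F F≡0ₕ F≡0w a       b = sym (F≡0ₕ a b z≤n)
coeff-applyUpTo (suc h) w F F≡0ₕ F≡0w zero    b = coeff₁-applyUpTo w (F 0) (F≡0w 0) b
coeff-applyUpTo (suc h) w F F≡0ₕ F≡0w (suc a) b =
  coeff-applyUpTo h w (F ∘ suc) (λ a b h≤a → F≡0ₕ (suc a) b (s≤s h≤a)) (F≡0w ∘ suc) a b

toPoly₂ : ∀ F → IsPolynomial F → Poly₂
toPoly₂ F (B , _) = applyUpTo (λ a → applyUpTo (F a) B) B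

coeff-toPoly₂ : ∀ F (F-poly : IsPolynomial F) a b → coeff (toPoly₂ F F-poly) a b ≡ F a b
coeff-toPoly₂ F (B , F≡0) = coeff-applyUpTo B B F
  (λ a b B≤a → F≡0 a b (ℕ.≤-trans B≤a (ℕ.m≤m+n a b)))
  (λ a b B≤b → F≡0 a b (ℕ.≤-trans B≤b (ℕ.m≤n+m b a)))

rational⇒expansion : ∀ c → Elimination.IsRational ℤ⟦X,Y⟧.seriesRing polynomialStructure (λ k n → + c k n) →
                     Σ (Poly₂ × Poly₂) λ (P , Q) → IsExpansionOf c P Q
rational⇒expansion c ((Q , P) , Q-poly , P-poly , Q₀₀≡1 , QF≋P) =
  (toPoly₂ P P-poly , toPoly₂ Q Q-poly) , Q₀₀≢0 , QF≡P
  where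
  F : Series₂
  F k n = + c k n
  Q₀₀≢0 : coeff (toPoly₂ Q Q-poly) 0 0 ≢ + 0
  Q₀₀≢0 eq with trans (sym Q₀₀≡1) (trans (sym (coeff-toPoly₂ Q Q-poly 0 0)) eq)
  ... | ()
  QF≡P : ∀ k n → ∑≤ k (λ a → ∑≤ n (λ b → coeff (toPoly₂ Q Q-poly) a b ℤ.* F (k ∸ a) (n ∸ b))) ≡
                 coeff (toPoly₂ P P-poly) k n
  QF≡P k n = begin
    ∑≤ k (λ a → ∑≤ n (λ b → coeff (toPoly₂ Q Q-poly) a b ℤ.* F (k ∸ a) (n ∸ b)))
      ≡⟨ *ₛ-coeff (coeff (toPoly₂ Q Q-poly)) F k n ⟨
    (coeff (toPoly₂ Q Q-poly) *ₛ F) k n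
      ≡⟨ ℤ⟦X,Y⟧.*ₛ-cong {g = F} (coeff-toPoly₂ Q Q-poly) (λ _ _ → refl) k n ⟩
    (Q *ₛ F) k n
      ≡⟨ QF≋P k n ⟩
    P k n
      ≡⟨ coeff-toPoly₂ P P-poly k n ⟨
    coeff (toPoly₂ P P-poly) k n ∎
    where open ≡-Reasoning

-- Counting bit vectors

count : ∀ n → (Vec Bool n → Bool) → ℕ
count zero    p = if p [] then 1 else 0
count (suc n) p = count n (p ∘ (false ∷_)) ℕ.+ count n (p ∘ (true ∷_))

count-false : ∀ n → count n (λ _ → false) ≡ 0
count-false zero    = refl
count-false (suc n) = cong₂ ℕ._+_ (count-false n) (count-false n)

Refinement-cong : ∀ {A : Set} {P Q : A → Set} → (∀ x → P x → Q x) → (∀ x → Q x → P x) →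
                  Refinement A P ↔ Refinement A Q
Refinement-cong P⇒Q Q⇒P = mk↔ₛ′ (λ (x , p) → x , Irrelevant.map (P⇒Q x) p)
                                (λ (x , q) → x , Irrelevant.map (Q⇒P x) q)
                                (λ _ → refl) (λ _ → refl)

Refinement-∷ : ∀ n (p : Vec Bool (suc n) → Bool) →
               Refinement (Vec Bool (suc n)) (T ∘ p) ↔
               (Refinement (Vec Bool n) (T ∘ p ∘ (false ∷_)) ⊎ Refinement (Vec Bool n) (T ∘ p ∘ (true ∷_)))
Refinement-∷ n p = mk↔ₛ′ split join
  (λ { (inj₁ _) → refl ; (inj₂ _) → refl })
  (λ { (false ∷ _ , _) → refl ; (true ∷ _ , _) → refl })
  where
  Split : Set
  Split = Refinement (Vec Bool n) (T ∘ p ∘ (false ∷_)) ⊎ Refinement (Vec Bool n) (T ∘ p ∘ (true ∷_))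
  split : Refinement (Vec Bool (suc n)) (T ∘ p) → Split
  split (false ∷ w , t) = inj₁ (w , t)
  split (true  ∷ w , t) = inj₂ (w , t)
  join : Split → Refinement (Vec Bool (suc n)) (T ∘ p)
  join (inj₁ (w , t)) = false ∷ w , t
  join (inj₂ (w , t)) = true  ∷ w , t

count-↔ : ∀ n (p : Vec Bool n → Bool) → Fin (count n p) ↔ Refinement (Vec Bool n) (T ∘ p)
count-↔ zero p with p [] in eq
... | true  = mk↔ₛ′ (λ _ → [] , [ subst T (sym eq) _ ]) (λ _ → zero)
                   (λ { ([] , _) → refl }) (λ { zero → refl ; (suc ()) })
... | false = mk↔ₛ′ (λ ()) (λ { ([] , [ t ]) → ⊥-elim-irr (subst T eq t) })
                   (λ { ([] , [ t ]) → ⊥-elim-irr (subst T eq t) }) (λ ())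
count-↔ (suc n) p = ↔-trans +↔⊎ (↔-trans (count-↔ n _ ⊎-↔ count-↔ n _) (↔-sym (Refinement-∷ n p)))

𝟙 : Bool → ℤ
𝟙 b = + (if b then 1 else 0)

select : ∀ {N} (r : Fin N) (φ : Fin N → ℤ) → sum (λ t → 𝟙 (does (r Fin.≟ t)) ℤ.* φ t) ≡ φ r
select {suc N} zero    φ =
  trans (cong₂ ℤ._+_ (ℤ.*-identityˡ (φ zero)) (∑ℤ.sum-replicate-zero N)) (ℤ.+-identityʳ (φ zero))
select {suc N} (suc r) φ =
  trans (ℤ.+-identityˡ (sum λ t → 𝟙 (does (r Fin.≟ t)) ℤ.* φ (suc t))) (select r (φ ∘ suc))

count-select : ∀ {N} n (β : Vec Bool n → Bool) (g : Vec Bool n → Fin N) (p : Fin N → Bool) →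
               + count n (λ w → β w ∧ p (g w)) ≡
               sum (λ t → 𝟙 (p t) ℤ.* + count n (λ w → β w ∧ does (g w Fin.≟ t)))
count-select {N} zero β g p with β []
... | false = sym (trans (∑ℤ.sum-cong-≗ λ t → ℤ.*-zeroʳ (𝟙 (p t))) (∑ℤ.sum-replicate-zero N))
... | true  = sym (trans (∑ℤ.sum-cong-≗ λ t → ℤ.*-comm (𝟙 (p t)) _) (select (g []) (𝟙 ∘ p)))
count-select {N} (suc n) β g p = begin
  + (count n (q false) ℕ.+ count n (q true))
    ≡⟨ ℤ.pos-+ (count n (q false)) (count n (q true)) ⟩
  + count n (q false) ℤ.+ + count n (q true)
    ≡⟨ cong₂ ℤ._+_ (count-select n _ _ p) (count-select n _ _ p) ⟩
  sum (λ t → 𝟙 (p t) ℤ.* + k false t) ℤ.+ sum (λ t → 𝟙 (p t) ℤ.* + k true t)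
    ≡⟨ ∑ℤ.∑-distrib-+ (λ t → 𝟙 (p t) ℤ.* + k false t) _ ⟨
  sum (λ t → 𝟙 (p t) ℤ.* + k false t ℤ.+ 𝟙 (p t) ℤ.* + k true t)
    ≡⟨ ∑ℤ.sum-cong-≗ (λ t → trans (sym (ℤ.*-distribˡ-+ (𝟙 (p t)) _ _))
                                  (cong (𝟙 (p t) ℤ.*_) (sym (ℤ.pos-+ (k false t) (k true t))))) ⟩
  sum (λ t → 𝟙 (p t) ℤ.* + count (suc n) (λ w → β w ∧ does (g w Fin.≟ t))) ∎
  where
  open ≡-Reasoning
  q : Bool → Vec Bool n → Bool
  q b w = β (b ∷ w) ∧ p (g (b ∷ w))
  k : Bool → Fin N → ℕ
  k b t = count n (λ w → β (b ∷ w) ∧ does (g (b ∷ w) Fin.≟ t))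

-- Finite automata

record Automaton (State : Set) : Set where
  field
    start  : State
    next   : State → Bool → State
    accept : State → Bool

  run : ∀ {n} → Vec Bool n → State
  run []      = start
  run (b ∷ w) = next (run w) b

  acceptedCount : ℕ → ℕ → ℕ
  acceptedCount k n = count (suc n) (λ w → (card w ≡ᵇ k) ∧ accept (run w))

-- The transfer-matrix method: the series Gₛ of words leading to state s satisfy
-- Gₛ = [start = s] + Y Σₜ (aₛₜ + X bₛₜ) Gₜ, where aₛₜ, bₛₜ ∈ {0, 1} record the transitions t → s on 0 and 1.
module TransferMatrix {N} (A : Automaton (Fin N)) where
  open Automaton A

  countBy : (Fin N → Bool) → Series₂
  countBy p k n = + count n (λ w → (card w ≡ᵇ k) ∧ p (run w))

  is : Fin N → Fin N → Bool
  is s t = does (t Fin.≟ s)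

  G : Fin N → Series₂
  G s = countBy (is s)

  countBy-select : ∀ p k n → countBy p k n ≡ sum (λ t → 𝟙 (p t) ℤ.* G t k n)
  countBy-select p k n = count-select n (λ w → card w ≡ᵇ k) run p

  after : Bool → (Fin N → Bool) → Fin N → Bool
  after b p t = p (next t b)

  countBy-suc-zero : ∀ p n → countBy p 0 (suc n) ≡ countBy (after false p) 0 n
  countBy-suc-zero p n = cong +_ (trans (cong (count n (λ w → (card w ≡ᵇ 0) ∧ after false p (run w)) ℕ.+_) (count-false n))
                                        (ℕ.+-identityʳ _))

  countBy-suc-suc : ∀ p k n → countBy p (suc k) (suc n) ≡ countBy (after false p) (suc k) n ℤ.+ countBy (after true p) k n
  countBy-suc-suc p k n = ℤ.pos-+ (count n (λ w → (card w ≡ᵇ suc k) ∧ after false p (run w))) _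

  letter : (Fin N → Bool) → Fin N → Series₂
  letter p t = ι₂ (𝟙 (after false p t)) +ₛ X *ₛ ι₂ (𝟙 (after true p t))

  letter-poly : ∀ p t → IsPolynomial (letter p t)
  letter-poly p t = poly-+ (ι₂-poly _) (poly-* X-poly (ι₂-poly _))

  letter-*-coeff : ∀ p t F k n → (letter p t *ₛ F) k n ≡
                   𝟙 (after false p t) ℤ.* F k n ℤ.+ (X *ₛ (ι₂ (𝟙 (after true p t)) *ₛ F)) k n
  letter-*-coeff p t F k n = trans (ℤ⟦X,Y⟧.*ₛ-distribʳ (ι₂ a) (X *ₛ ι₂ b) F k n)
                                   (cong₂ ℤ._+_ (ι₂-* a F k n) (ℤ⟦X,Y⟧.*ₛ-assoc X (ι₂ b) F k n))
    where
    a b : ℤ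
    a = 𝟙 (after false p t)
    b = 𝟙 (after true p t)

  letter-*-zero : ∀ p t F n → (letter p t *ₛ F) 0 n ≡ 𝟙 (after false p t) ℤ.* F 0 n
  letter-*-zero p t F n = trans (letter-*-coeff p t F 0 n)
    (trans (cong (λ x → 𝟙 (after false p t) ℤ.* F 0 n ℤ.+ x) (X-*-zero (ι₂ (𝟙 (after true p t)) *ₛ F) n))
           (ℤ.+-identityʳ (𝟙 (after false p t) ℤ.* F 0 n)))

  letter-*-suc : ∀ p t F k n →
                 (letter p t *ₛ F) (suc k) n ≡ 𝟙 (after false p t) ℤ.* F (suc k) n ℤ.+ 𝟙 (after true p t) ℤ.* F k n
  letter-*-suc p t F k n = trans (letter-*-coeff p t F (suc k) n)
    (cong (λ x → 𝟙 (after false p t) ℤ.* F (suc k) n ℤ.+ x)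
          (trans (X-*-suc (ι₂ (𝟙 (after true p t)) *ₛ F) k n) (ι₂-* (𝟙 (after true p t)) F k n)))

  countBy-suc : ∀ p k n → countBy p k (suc n) ≡ sum (λ t → (letter p t *ₛ G t) k n)
  countBy-suc p zero n = begin
    countBy p 0 (suc n)                                   ≡⟨ countBy-suc-zero p n ⟩
    countBy (after false p) 0 n                           ≡⟨ countBy-select (after false p) 0 n ⟩
    sum (λ t → 𝟙 (after false p t) ℤ.* G t 0 n)           ≡⟨ ∑ℤ.sum-cong-≗ (λ t → letter-*-zero p t (G t) n) ⟨
    sum (λ t → (letter p t *ₛ G t) 0 n)                   ∎
    where open ≡-Reasoning
  countBy-suc p (suc k) n = begin
    countBy p (suc k) (suc n)
      ≡⟨ countBy-suc-suc p k n ⟩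
    countBy (after false p) (suc k) n ℤ.+ countBy (after true p) k n
      ≡⟨ cong₂ ℤ._+_ (countBy-select (after false p) (suc k) n) (countBy-select (after true p) k n) ⟩
    sum (λ t → 𝟙 (after false p t) ℤ.* G t (suc k) n) ℤ.+ sum (λ t → 𝟙 (after true p t) ℤ.* G t k n)
      ≡⟨ ∑ℤ.∑-distrib-+ (λ t → 𝟙 (after false p t) ℤ.* G t (suc k) n) _ ⟨
    sum (λ t → 𝟙 (after false p t) ℤ.* G t (suc k) n ℤ.+ 𝟙 (after true p t) ℤ.* G t k n)
      ≡⟨ ∑ℤ.sum-cong-≗ (λ t → letter-*-suc p t (G t) k n) ⟨
    sum (λ t → (letter p t *ₛ G t) (suc k) n) ∎
    where open ≡-Reasoning

  G-recurrence : ∀ s k n → G s k n ≡ ι₂ (𝟙 (is s start)) k n ℤ.+ sum (λ t → (Y *ₛ (letter (is s) t *ₛ G t)) k n)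
  G-recurrence s k zero = sym (trans
    (cong (λ x → ι₂ (𝟙 (is s start)) k 0 ℤ.+ x)
          (trans (∑ℤ.sum-cong-≗ λ t → Y-*-zero (letter (is s) t *ₛ G t) k) (∑ℤ.sum-replicate-zero N)))
    (trans (ℤ.+-identityʳ _) (G-empty k)))
    where
    G-empty : ∀ k → ι₂ (𝟙 (is s start)) k 0 ≡ G s k 0
    G-empty zero    = refl
    G-empty (suc k) = refl
  G-recurrence s k (suc n) = begin
    G s k (suc n)
      ≡⟨ countBy-suc (is s) k n ⟩
    sum (λ t → (letter (is s) t *ₛ G t) k n)
      ≡⟨ ∑ℤ.sum-cong-≗ (λ t → Y-*-suc (letter (is s) t *ₛ G t) k n) ⟨
    sum (λ t → (Y *ₛ (letter (is s) t *ₛ G t)) k (suc n))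
      ≡⟨ ℤ.+-identityˡ _ ⟨
    + 0 ℤ.+ sum (λ t → (Y *ₛ (letter (is s) t *ₛ G t)) k (suc n))
      ≡⟨ cong (ℤ._+ sum (λ t → (Y *ₛ (letter (is s) t *ₛ G t)) k (suc n))) (ι₂-suc (𝟙 (is s start)) k n) ⟨
    ι₂ (𝟙 (is s start)) k (suc n) ℤ.+ sum (λ t → (Y *ₛ (letter (is s) t *ₛ G t)) k (suc n)) ∎
    where open ≡-Reasoning

  G-equation : ∀ s k n →
               (1ₛ *ₛ G s) k n ≡ (ι₂ (𝟙 (is s start)) +ₛ ∑₂.sum (λ t → (Y *ₛ letter (is s) t) *ₛ G t)) k n
  G-equation s k n = begin
    (1ₛ *ₛ G s) k n
      ≡⟨ ℤ⟦X,Y⟧.*ₛ-identityˡ (G s) k n ⟩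
    G s k n
      ≡⟨ G-recurrence s k n ⟩
    c k n ℤ.+ sum (λ t → (Y *ₛ (letter (is s) t *ₛ G t)) k n)
      ≡⟨ cong (λ x → c k n ℤ.+ x) (∑ℤ.sum-cong-≗ λ t → ℤ⟦X,Y⟧.*ₛ-assoc Y (letter (is s) t) (G t) k n) ⟨
    c k n ℤ.+ sum (λ t → ((Y *ₛ letter (is s) t) *ₛ G t) k n)
      ≡⟨ cong (λ x → c k n ℤ.+ x) (∑₂-coeff (λ t → (Y *ₛ letter (is s) t) *ₛ G t) k n) ⟨
    (c +ₛ ∑₂.sum (λ t → (Y *ₛ letter (is s) t) *ₛ G t)) k n ∎
    where
    open ≡-Reasoning
    c : Series₂
    c = ι₂ (𝟙 (is s start))

  acceptedSeries : Series₂
  acceptedSeries k n = + acceptedCount k n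

  accepted-equation : ∀ k n → (1ₛ *ₛ acceptedSeries) k n ≡ (0ₛ +ₛ ∑₂.sum (λ t → letter accept t *ₛ G t)) k n
  accepted-equation k n = begin
    (1ₛ *ₛ acceptedSeries) k n                    ≡⟨ ℤ⟦X,Y⟧.*ₛ-identityˡ acceptedSeries k n ⟩
    countBy accept k (suc n)                      ≡⟨ countBy-suc accept k n ⟩
    sum (λ t → (letter accept t *ₛ G t) k n)      ≡⟨ ∑₂-coeff (λ t → letter accept t *ₛ G t) k n ⟨
    ∑₂.sum (λ t → letter accept t *ₛ G t) k n     ≡⟨ ℤ.+-identityˡ _ ⟨
    (0ₛ +ₛ ∑₂.sum (λ t → letter accept t *ₛ G t)) k n ∎
    where open ≡-Reasoning

  open Elimination ℤ⟦X,Y⟧.seriesRing using (LinearSystem; solve)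

  system : LinearSystem polynomialStructure N acceptedSeries
  system = record
    { unknown          = G
    ; diagonal         = 1ₛ
    ; constant         = λ s → ι₂ (𝟙 (is s start))
    ; coefficient      = λ s t → Y *ₛ letter (is s) t
    ; equation         = G-equation
    ; scale            = 1ₛ
    ; offset           = 0ₛ
    ; weight           = letter accept
    ; output           = accepted-equation
    ; diagonal-poly    = ι₂-poly (+ 1)
    ; constant-poly    = λ s → ι₂-poly _
    ; coefficient-poly = λ s t → poly-* Y-poly (letter-poly (is s) t)
    ; scale-poly       = ι₂-poly (+ 1)
    ; offset-poly      = 0ₛ-poly
    ; weight-poly      = letter-poly accept
    ; diagonal-one     = refl
    ; coefficient-zero = λ s t → Y-*-zero (letter (is s) t) 0
    ; scale-one        = refl
    }

  acceptedCount-rational : Σ (Poly₂ × Poly₂) λ (P , Q) → IsExpansionOf acceptedCount P Q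
  acceptedCount-rational = rational⇒expansion acceptedCount (solve polynomialStructure system)

module _ {State : Set} {N} (encoding : State ↔ Fin N) (A : Automaton State) where
  open Inverse encoding using (to; from; strictlyInverseʳ)
  open Automaton A

  encode : Automaton (Fin N)
  encode = record
    { start  = to start
    ; next   = λ i b → to (next (from i) b)
    ; accept = λ i → accept (from i)
    }

  run-encode : ∀ {n} (w : Vec Bool n) → Automaton.run encode w ≡ to (run w)
  run-encode []      = refl
  run-encode (b ∷ w) = trans (cong (λ i → to (next (from i) b)) (run-encode w))
                             (cong (λ s → to (next s b)) (strictlyInverseʳ (run w)))

  accept-encode : ∀ {n} (w : Vec Bool n) → Automaton.accept encode (Automaton.run encode w) ≡ accept (run w)
  accept-encode w = trans (cong (accept ∘ from) (run-encode w)) (cong accept (strictlyInverseʳ (run w)))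

-- Shadows

[+m]-[+n]≡+[m∸n] : ∀ {m n} → n ≤ m → + m ℤ.- + n ≡ + (m ∸ n)
[+m]-[+n]≡+[m∸n] {m} {n} n≤m = trans (ℤ.[+m]-[+n]≡m⊖n m n) (ℤ.⊖-≥ n≤m)

[+m]-[+n]≡-[n∸m] : ∀ {m n} → m ≤ n → + m ℤ.- + n ≡ ℤ.- + (n ∸ m)
[+m]-[+n]≡-[n∸m] {m} {n} m≤n = trans (ℤ.[+m]-[+n]≡m⊖n m n) (ℤ.⊖-≤ m≤n)

[i∸u]+[w∸i]≡w∸u : ∀ {u i w} → u ≤ i → i ≤ w → (i ∸ u) ℕ.+ (w ∸ i) ≡ w ∸ u
[i∸u]+[w∸i]≡w∸u {u} {i} {w} u≤i i≤w = trans (ℕ.+-comm (i ∸ u) (w ∸ i))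
  (trans (sym (ℕ.+-∸-assoc (w ∸ i) u≤i)) (cong (_∸ u) (ℕ.m∸n+n≡m i≤w)))

mem : ∀ {n} → Vec Bool n → ℕ → Bool
mem D i = memb i D

memb⇒< : ∀ {n} i (D : Vec Bool n) → memb i D ≡ true → i < n
memb⇒< zero    (b ∷ D) _    = s≤s z≤n
memb⇒< (suc i) (b ∷ D) i∈D = s≤s (memb⇒< i D i∈D)

memb-≥ : ∀ {n} (D : Vec Bool n) i → n ≤ i → memb i D ≡ false
memb-≥ []      i       _         = refl
memb-≥ (b ∷ D) (suc i) (s≤s n≤i) = memb-≥ D i n≤i

module Crossing (S : List ℤ) (m : ℕ) where

  Crossed : (ℕ → Bool) → ℕ → Set
  Crossed f j = Σ ℕ λ u → u < j × Σ ℕ λ d → d < suc m ×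
                (j ≤ u ℕ.+ d × f u ≡ true × f (u ℕ.+ d) ≡ true × + d ∈ S)

  crossed? : ∀ f j → Dec (Crossed f j)
  crossed? f j = ℕ.anyUpTo? (λ u → ℕ.anyUpTo? (λ d →
    (j ≤? u ℕ.+ d) ×-dec (f u Bool.≟ true) ×-dec (f (u ℕ.+ d) Bool.≟ true) ×-dec (+ d ∈? S)) (suc m)) j

  Crossed-cong : ∀ {f g j} → (∀ x → x < j ℕ.+ m → f x ≡ g x) → Crossed f j → Crossed g j
  Crossed-cong f≡g (u , u<j , d , d≤m , j≤u+d , fu , fu+d , d∈S) =
    u , u<j , d , d≤m , j≤u+d ,
    trans (sym (f≡g u (ℕ.<-≤-trans u<j (ℕ.m≤m+n _ m)))) fu ,
    trans (sym (f≡g (u ℕ.+ d) (ℕ.+-mono-<-≤ u<j (ℕ.≤-pred d≤m)))) fu+d , d∈S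

  Crossed-∷ : ∀ {n} b (D : Vec Bool n) {j} → Crossed (mem D) j → Crossed (mem (b ∷ D)) (suc j)
  Crossed-∷ b D (u , u<j , d , d≤m , j≤u+d , rest) = suc u , s≤s u<j , d , d≤m , s≤s j≤u+d , rest

  Crossed-∷⁻ : ∀ {n} b (D : Vec Bool n) {j} → m ≤ j → Crossed (mem (b ∷ D)) (suc j) → Crossed (mem D) j
  Crossed-∷⁻ b D m≤j (zero , _ , d , s≤s d≤m , 1+j≤d , _) =
    contradiction (ℕ.≤-trans 1+j≤d (ℕ.≤-trans d≤m m≤j)) (ℕ.n≮n _)
  Crossed-∷⁻ b D m≤j (suc u , s≤s u<j , d , d≤m , s≤s j≤u+d , rest) = u , u<j , d , d≤m , j≤u+d , rest

  AllCrossed : ∀ {n} → Vec Bool n → ℕ → Set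
  AllCrossed D n = ∀ j → 1 ≤ j → j ≤ n → Crossed (mem D) j

  module Characterisation (S-sym : SymmetricSet S) (S-closed : ComplClosed S) (S-max : IsMax S m) where

    reach-memb : ∀ {n} {D : Vec Bool n} {i} → memb 0 D ≡ true → Reach S D i → memb i D ≡ true
    reach-memb 0∈D here           = 0∈D
    reach-memb 0∈D (step _ j∈D _) = j∈D

    reach⇒crossed : ∀ {n} {D : Vec Bool n} {i} → memb 0 D ≡ true → Reach S D i → AllCrossed D i
    reach⇒crossed 0∈D here j (s≤s z≤n) ()
    reach⇒crossed {D = D} 0∈D (step {i} {i′} r i′∈D e) j 1≤j j≤i′ with j ≤? i
    ... | yes j≤i = reach⇒crossed 0∈D r j 1≤j j≤i
    ... | no  j≰i = i , i<j , i′ ∸ i , s≤s (ℤ.drop‿+≤+ (proj₂ S-max _ d∈S)) ,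
                    subst (j ≤_) (sym i+d≡i′) j≤i′ , reach-memb 0∈D r ,
                    subst (λ x → memb x D ≡ true) (sym i+d≡i′) i′∈D , d∈S
      where
      i<j : i < j
      i<j = ℕ.≰⇒> j≰i
      i≤i′ : i ≤ i′
      i≤i′ = ℕ.<⇒≤ (ℕ.<-≤-trans i<j j≤i′)
      i+d≡i′ : i ℕ.+ (i′ ∸ i) ≡ i′
      i+d≡i′ = ℕ.m+[n∸m]≡n i≤i′
      d∈S : + (i′ ∸ i) ∈ S
      d∈S = subst (_∈ S) ([+m]-[+n]≡+[m∸n] i≤i′) e

    -- A crossing edge u → w = u + d of i gives an edge u → i or w → i: otherwise i − u and w − i are
    -- non-edges with sum d ∈ S, contradicting ComplClosed (and w → i is an edge since S = −S).
    crossed⇒reach : ∀ {n} {D : Vec Bool (suc n)} → memb 0 D ≡ true → AllCrossed D n →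
                    ∀ i → memb i D ≡ true → Reach S D i
    crossed⇒reach {n} {D} 0∈D crossed = <-rec _ reach
      where
      reach : ∀ i → (∀ {u} → u < i → memb u D ≡ true → Reach S D u) → memb i D ≡ true → Reach S D i
      reach zero    _   _   = here
      reach (suc t) rec i∈D with crossed (suc t) (s≤s z≤n) (ℕ.≤-pred (memb⇒< (suc t) D i∈D))
      ... | u , u<i , d , _ , i≤w , u∈D , w∈D , d∈S with + (suc t ∸ u) ∈? S
      ...   | yes a∈S = step (rec u<i u∈D) i∈D (subst (_∈ S) (sym ([+m]-[+n]≡+[m∸n] (ℕ.<⇒≤ u<i))) a∈S)
      ...   | no  a∉S with + (u ℕ.+ d ∸ suc t) ∈? S
      ...     | yes b∈S = step (step (rec u<i u∈D) w∈D u→w) i∈D w→i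
        where
        u→w : + (u ℕ.+ d) ℤ.- + u ∈ S
        u→w = subst (_∈ S) (sym (trans ([+m]-[+n]≡+[m∸n] (ℕ.m≤m+n u d)) (cong +_ (ℕ.m+n∸m≡n u d)))) d∈S
        w→i : + suc t ℤ.- + (u ℕ.+ d) ∈ S
        w→i = subst (_∈ S) (sym ([+m]-[+n]≡-[n∸m] i≤w)) (S-sym _ b∈S)
      ...     | no  b∉S = ⊥-elim (S-closed _ _ a∉S b∉S (subst (λ x → + x ∈ S) (sym a+b≡d) d∈S))
        where
        a+b≡d : (suc t ∸ u) ℕ.+ (u ℕ.+ d ∸ suc t) ≡ d
        a+b≡d = trans ([i∸u]+[w∸i]≡w∸u (ℕ.<⇒≤ u<i) i≤w) (ℕ.m+n∸m≡n u d)

    isShadow⇔ : ∀ {n} (D : Vec Bool (suc n)) → IsShadow S D ⇔ (memb 0 D ≡ true × memb n D ≡ true × AllCrossed D n)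
    isShadow⇔ {n} D = mk⇔ (λ (0∈D , n∈D , reach) → 0∈D , n∈D , reach⇒crossed 0∈D (reach n n∈D))
                          (λ (0∈D , n∈D , crossed) → 0∈D , n∈D , crossed⇒reach 0∈D crossed)

at : ∀ {k} → ℕ → Vec (Maybe Bool) k → Maybe Bool
at i       []      = nothing
at zero    (x ∷ W) = x
at (suc i) (x ∷ W) = at i W

push : ∀ {k} → Maybe Bool → Vec (Maybe Bool) k → Vec (Maybe Bool) k
push x []      = []
push x (y ∷ W) = x ∷ push y W

at-push : ∀ {k} i x (W : Vec (Maybe Bool) k) → i < k → at i (push x W) ≡ at i (x ∷ W)
at-push zero    x (y ∷ W) _         = refl
at-push (suc i) x (y ∷ W) (s≤s i<k) = at-push i y W i<k

at-replicate : ∀ k i → at i (replicate k nothing) ≡ nothing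
at-replicate zero    i       = refl
at-replicate (suc k) zero    = refl
at-replicate (suc k) (suc i) = at-replicate k i

≤pred⇒< : ∀ {i m} → 1 ≤ i → i ≤ m ∸ 1 → i < m
≤pred⇒< {m = zero}  (s≤s z≤n) ()
≤pred⇒< {m = suc m} _         i≤m = s≤s i≤m

≤ᵇ-∧ : ∀ {i n x} → i ≤ n → ((i ≤ᵇ n) ∧ x) ≡ x
≤ᵇ-∧ {i} {n} i≤n with i ≤ᵇ n in eq
... | true  = refl
... | false = contradiction (subst T eq (ℕ.≤⇒≤ᵇ i≤n)) λ ()

≰ᵇ-∧ : ∀ {i n x} → n < i → ((i ≤ᵇ n) ∧ x) ≡ false
≰ᵇ-∧ {i} {n} n<i with i ≤ᵇ n in eq
... | false = refl
... | true  = contradiction (ℕ.≤ᵇ⇒≤ i n (subst T (sym eq) tt)) (ℕ.<⇒≱ n<i)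

T-∧-isYes : ∀ {P : Set} x (d : Dec P) → T (x ∧ isYes d) ⇔ (T x × P)
T-∧-isYes x d = mk⇔ (λ t → let (tx , td) = Equivalence.to Bool.T-∧ t in tx , toWitness td)
                    (λ (tx , p) → Equivalence.from Bool.T-∧ (tx , fromWitness p))

-- The automaton reads D from its last letter down to D[0]. After reading a suffix E its state is a validity
-- flag and the window of the first L letters of E (nothing past the end of E). A position j ≥ h of D is
-- checked for a crossing when it is position h of the suffix read so far, where the window covers every
-- edge of length ≤ m through it; the bit just read is at distance |E| − 1 from the top of D, which decides
-- the end condition. Positions below h and the start condition are checked on the final window.
module WindowAutomaton (S : List ℤ) (m : ℕ) (U V : ℕ → Bool) where
  open Crossing S m

  h L : ℕ
  h = suc m
  L = suc (h ℕ.+ m)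

  Window : Set
  Window = Vec (Maybe Bool) L

  h+m<L : h ℕ.+ m < L
  h+m<L = ℕ.n<1+n (h ℕ.+ m)

  h<L : h < L
  h<L = ℕ.≤-<-trans (ℕ.m≤m+n h m) h+m<L

  i<m⇒suc-i<L : ∀ {i} → i < m → suc i < L
  i<m⇒suc-i<L i<m = s≤s (s≤s (ℕ.≤-trans (ℕ.<⇒≤ i<m) (ℕ.m≤m+n m m)))

  <m⇒<L : ∀ {i} → i < m → i < L
  <m⇒<L i<m = ℕ.<-trans (ℕ.n<1+n _) (i<m⇒suc-i<L i<m)

  bit present : Window → ℕ → Bool
  bit     W i = fromMaybe false (at i W)
  present W i = is-just (at i W)

  TopCheck EndCheck CrossingCheck Check : Window → Set
  TopCheck      W = present W 1 ≡ false → bit W 0 ≡ true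
  EndCheck      W = ∀ {i} → i < m → 1 ≤ i → present W i ≡ true → present W (suc i) ≡ false → V i ≡ bit W 0
  CrossingCheck W = present W h ≡ true → Crossed (bit W) h
  Check         W = TopCheck W × EndCheck W × CrossingCheck W

  StartCheck ShortEndCheck LowCrossingCheck Final : Window → Set
  StartCheck       W = ∀ {i} → i < m → 1 ≤ i → bit W i ≡ U i
  ShortEndCheck    W = ∀ {i} → i < m → 1 ≤ i → present W i ≡ false → V i ≡ false
  LowCrossingCheck W = ∀ {j} → j < h → 1 ≤ j → present W j ≡ true → Crossed (bit W) j
  Final            W = bit W 0 ≡ true × StartCheck W × ShortEndCheck W × LowCrossingCheck W

  check? : ∀ W → Dec (Check W)
  check? W = ((present W 1 Bool.≟ false) →-dec (bit W 0 Bool.≟ true))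
       ×-dec ℕ.allUpTo? (λ i → (1 ≤? i) →-dec ((present W i Bool.≟ true) →-dec
                                ((present W (suc i) Bool.≟ false) →-dec (V i Bool.≟ bit W 0)))) m
       ×-dec ((present W h Bool.≟ true) →-dec crossed? (bit W) h)

  final? : ∀ W → Dec (Final W)
  final? W = (bit W 0 Bool.≟ true)
       ×-dec ℕ.allUpTo? (λ i → (1 ≤? i) →-dec (bit W i Bool.≟ U i)) m
       ×-dec ℕ.allUpTo? (λ i → (1 ≤? i) →-dec ((present W i Bool.≟ false) →-dec (V i Bool.≟ false))) m
       ×-dec ℕ.allUpTo? (λ j → (1 ≤? j) →-dec ((present W j Bool.≟ true) →-dec crossed? (bit W) j)) h

  automaton : Automaton (Bool × Window)
  automaton = record
    { start  = true , replicate L nothing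
    ; next   = λ (valid , W) b → valid ∧ isYes (check? (push (just b) W)) , push (just b) W
    ; accept = λ (valid , W) → valid ∧ isYes (final? W)
    }

  open Automaton automaton using (run)

  window : ∀ {ℓ} → Vec Bool ℓ → Window
  window E = proj₂ (run E)

  window-< : ∀ {ℓ} (E : Vec Bool ℓ) i → i < L → i < ℓ → at i (window E) ≡ just (memb i E)
  window-< (b ∷ E) i       i<L i<ℓ with at-push i (just b) (window E) i<L
  window-< (b ∷ E) zero    i<L _         | eq = eq
  window-< (b ∷ E) (suc i) i<L (s≤s i<ℓ) | eq = trans eq (window-< E i (ℕ.<-trans (ℕ.n<1+n i) i<L) i<ℓ)

  window-≥ : ∀ {ℓ} (E : Vec Bool ℓ) i → i < L → ℓ ≤ i → at i (window E) ≡ nothing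
  window-≥ []      i       _   _         = at-replicate L i
  window-≥ (b ∷ E) (suc i) i<L (s≤s ℓ≤i) =
    trans (at-push (suc i) (just b) (window E) i<L) (window-≥ E i (ℕ.<-trans (ℕ.n<1+n i) i<L) ℓ≤i)

  bit-window : ∀ {ℓ} (E : Vec Bool ℓ) i → i < L → bit (window E) i ≡ memb i E
  bit-window {ℓ} E i i<L with i <? ℓ
  ... | yes i<ℓ = cong (fromMaybe false) (window-< E i i<L i<ℓ)
  ... | no  i≮ℓ = trans (cong (fromMaybe false) (window-≥ E i i<L ℓ≤i)) (sym (memb-≥ E i ℓ≤i))
    where
    ℓ≤i : ℓ ≤ i
    ℓ≤i = ℕ.≮⇒≥ i≮ℓ

  present-< : ∀ {ℓ} (E : Vec Bool ℓ) i → i < L → i < ℓ → present (window E) i ≡ true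
  present-< E i i<L i<ℓ = cong is-just (window-< E i i<L i<ℓ)

  present-≥ : ∀ {ℓ} (E : Vec Bool ℓ) i → i < L → ℓ ≤ i → present (window E) i ≡ false
  present-≥ E i i<L ℓ≤i = cong is-just (window-≥ E i i<L ℓ≤i)

  present⇒< : ∀ {ℓ} (E : Vec Bool ℓ) i → i < L → present (window E) i ≡ true → i < ℓ
  present⇒< {ℓ} E i i<L present with i <? ℓ
  ... | yes i<ℓ = i<ℓ
  ... | no  i≮ℓ = contradiction (trans (sym present) (present-≥ E i i<L (ℕ.≮⇒≥ i≮ℓ))) λ ()

  absent⇒≥ : ∀ {ℓ} (E : Vec Bool ℓ) i → i < L → present (window E) i ≡ false → ℓ ≤ i
  absent⇒≥ {ℓ} E i i<L absent with i <? ℓ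
  ... | yes i<ℓ = contradiction (trans (sym absent) (present-< E i i<L i<ℓ)) λ ()
  ... | no  i≮ℓ = ℕ.≮⇒≥ i≮ℓ

  Top : ∀ {ℓ} → Vec Bool ℓ → Set
  Top {zero}  E = ⊤
  Top {suc p} E = memb p E ≡ true

  EndMatches : ∀ {ℓ} → Vec Bool ℓ → Set
  EndMatches {ℓ} E = ∀ i → 1 ≤ i → i < m → i < ℓ → V i ≡ memb (ℓ ∸ suc i) E

  CrossedAbove : ∀ {ℓ} → Vec Bool ℓ → Set
  CrossedAbove {ℓ} E = ∀ j → h ≤ j → j < ℓ → Crossed (mem E) j

  Invariant : ∀ {ℓ} → Vec Bool ℓ → Set
  Invariant E = Top E × EndMatches E × CrossedAbove E

  Top-∷ : ∀ {ℓ} b (E : Vec Bool ℓ) → Top (b ∷ E) ⇔ (Top E × TopCheck (window (b ∷ E)))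
  Top-∷ b [] = mk⇔ (λ b≡true → tt , λ _ → trans (bit-window (b ∷ []) 0 (s≤s z≤n)) b≡true)
                   (λ (_ , check) → trans (sym (bit-window (b ∷ []) 0 (s≤s z≤n)))
                                          (check (present-≥ (b ∷ []) 1 (s≤s (s≤s z≤n)) ℕ.≤-refl)))
  Top-∷ b (c ∷ E) = mk⇔ (λ top → top , λ absent → contradiction (trans (sym absent) 1-present) λ ()) proj₁
    where
    1-present : present (window (b ∷ c ∷ E)) 1 ≡ true
    1-present = present-< (b ∷ c ∷ E) 1 (s≤s (s≤s z≤n)) (s≤s (s≤s z≤n))

  memb-top : ∀ {ℓ} b (E : Vec Bool ℓ) {i} → ℓ ≤ i → memb (ℓ ∸ i) (b ∷ E) ≡ b
  memb-top b E ℓ≤i = cong (λ x → memb x (b ∷ E)) (ℕ.m≤n⇒m∸n≡0 ℓ≤i)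

  EndMatches-∷ : ∀ {ℓ} b (E : Vec Bool ℓ) → EndMatches (b ∷ E) ⇔ (EndMatches E × EndCheck (window (b ∷ E)))
  EndMatches-∷ {ℓ} b E = mk⇔
    (λ end → (λ i 1≤i i<m i<ℓ → trans (end i 1≤i i<m (ℕ.m<n⇒m<1+n i<ℓ))
                                       (cong (λ x → memb x (b ∷ E)) (ℕ.+-∸-assoc 1 i<ℓ)))
           , (λ {i} i<m 1≤i present absent →
                trans (end i 1≤i i<m (present⇒< (b ∷ E) i (<m⇒<L i<m) present))
                      (trans (memb-top b E (ℕ.≤-pred (absent⇒≥ (b ∷ E) (suc i) (i<m⇒suc-i<L i<m) absent)))
                             (sym (bit-window (b ∷ E) 0 (s≤s z≤n))))))
    (λ (end , check) i 1≤i i<m i<1+ℓ → case i <? ℓ of λ where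
       (yes i<ℓ) → trans (end i 1≤i i<m i<ℓ) (sym (cong (λ x → memb x (b ∷ E)) (ℕ.+-∸-assoc 1 i<ℓ)))
       (no  i≮ℓ) → trans (check i<m 1≤i (present-< (b ∷ E) i (<m⇒<L i<m) i<1+ℓ)
                                       (present-≥ (b ∷ E) (suc i) (i<m⇒suc-i<L i<m) (s≤s (ℕ.≮⇒≥ i≮ℓ))))
                         (trans (bit-window (b ∷ E) 0 (s≤s z≤n)) (sym (memb-top b E (ℕ.≮⇒≥ i≮ℓ)))))

  Crossed-window : ∀ {ℓ} (E : Vec Bool ℓ) {j} → j ≤ h → Crossed (mem E) j ⇔ Crossed (bit (window E)) j
  Crossed-window E {j} j≤h = mk⇔ (Crossed-cong λ x x<j+m → sym (bit-window E x (bound x<j+m)))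
                                 (Crossed-cong λ x x<j+m → bit-window E x (bound x<j+m))
    where
    bound : ∀ {x} → x < j ℕ.+ m → x < L
    bound x<j+m = ℕ.<-trans (ℕ.<-≤-trans x<j+m (ℕ.+-monoˡ-≤ m j≤h)) h+m<L

  CrossedAbove-∷ : ∀ {ℓ} b (E : Vec Bool ℓ) → CrossedAbove (b ∷ E) ⇔ (CrossedAbove E × CrossingCheck (window (b ∷ E)))
  CrossedAbove-∷ {ℓ} b E = mk⇔
    (λ above → (λ j h≤j j<ℓ → Crossed-∷⁻ b E (ℕ.<⇒≤ h≤j) (above (suc j) (ℕ.m≤n⇒m≤1+n h≤j) (s≤s j<ℓ)))
             , (λ present → Equivalence.to (Crossed-window (b ∷ E) ℕ.≤-refl)
                                           (above h ℕ.≤-refl (present⇒< (b ∷ E) h h<L present))))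
    (λ (above , check) j h≤j j<1+ℓ → case ℕ.m≤n⇒m<n∨m≡n h≤j of λ where
       (inj₂ refl) → Equivalence.from (Crossed-window (b ∷ E) ℕ.≤-refl) (check (present-< (b ∷ E) h h<L j<1+ℓ))
       (inj₁ h<j)  → above-suc above h<j j<1+ℓ)
    where
    above-suc : CrossedAbove E → ∀ {j} → h < j → j < suc ℓ → Crossed (mem (b ∷ E)) j
    above-suc above {suc j} (s≤s h≤j) (s≤s j<ℓ) = Crossed-∷ b E (above j h≤j j<ℓ)

  Invariant-∷ : ∀ {ℓ} b (E : Vec Bool ℓ) → Invariant (b ∷ E) ⇔ (Invariant E × Check (window (b ∷ E)))
  Invariant-∷ b E = mk⇔
    (λ (top , end , above) →
       let (topE , topC) = Equivalence.to (Top-∷ b E) top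
           (endE , endC) = Equivalence.to (EndMatches-∷ b E) end
           (aboveE , aboveC) = Equivalence.to (CrossedAbove-∷ b E) above
       in (topE , endE , aboveE) , topC , endC , aboveC)
    (λ ((topE , endE , aboveE) , topC , endC , aboveC) →
       Equivalence.from (Top-∷ b E) (topE , topC) ,
       Equivalence.from (EndMatches-∷ b E) (endE , endC) ,
       Equivalence.from (CrossedAbove-∷ b E) (aboveE , aboveC))

  valid : ∀ {ℓ} → Vec Bool ℓ → Bool
  valid E = proj₁ (run E)

  valid⇔ : ∀ {ℓ} (E : Vec Bool ℓ) → T (valid E) ⇔ Invariant E
  valid⇔ []      = mk⇔ (λ _ → tt , (λ _ _ _ ()) , (λ _ _ ())) (λ _ → tt)
  valid⇔ (b ∷ E) =
    ⇔-sym (Invariant-∷ b E) ⇔-∘ ((valid⇔ E ×-⇔ ⇔-id _) ⇔-∘ T-∧-isYes (valid E) (check? (window (b ∷ E))))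

  StartIs⇔ : ∀ {n} (D : Vec Bool (suc n)) → StartIs m D U ⇔ StartCheck (window D)
  StartIs⇔ D = mk⇔
    (λ start {i} i<m 1≤i → trans (bit-window D i (<m⇒<L i<m)) (start i 1≤i (ℕ.<⇒≤pred i<m)))
    (λ start i 1≤i i≤m-1 → let i<m = ≤pred⇒< 1≤i i≤m-1 in trans (sym (bit-window D i (<m⇒<L i<m))) (start i<m 1≤i))

  EndIs⇔ : ∀ {n} (D : Vec Bool (suc n)) → EndIs m D V ⇔ (EndMatches D × ShortEndCheck (window D))
  EndIs⇔ {n} D = mk⇔
    (λ end → (λ i 1≤i i<m i<1+n → trans (end i 1≤i (ℕ.<⇒≤pred i<m)) (≤ᵇ-∧ (ℕ.≤-pred i<1+n)))
           , (λ {i} i<m 1≤i absent → trans (end i 1≤i (ℕ.<⇒≤pred i<m)) (≰ᵇ-∧ (absent⇒≥ D i (<m⇒<L i<m) absent))))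
    (λ (match , beyond) i 1≤i i≤m-1 → let i<m = ≤pred⇒< 1≤i i≤m-1 in case i ≤? n of λ where
       (yes i≤n) → trans (match i 1≤i i<m (s≤s i≤n)) (sym (≤ᵇ-∧ i≤n))
       (no  i≰n) → trans (beyond i<m 1≤i (present-≥ D i (<m⇒<L i<m) (ℕ.≰⇒> i≰n))) (sym (≰ᵇ-∧ (ℕ.≰⇒> i≰n))))

  AllCrossed⇔ : ∀ {n} (D : Vec Bool (suc n)) → AllCrossed D n ⇔ (CrossedAbove D × LowCrossingCheck (window D))
  AllCrossed⇔ {n} D = mk⇔
    (λ crossed → (λ j h≤j j<1+n → crossed j (ℕ.≤-trans (s≤s z≤n) h≤j) (ℕ.≤-pred j<1+n))
               , (λ {j} j<h 1≤j present → Equivalence.to (Crossed-window D (ℕ.<⇒≤ j<h))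
                                            (crossed j 1≤j (ℕ.≤-pred (present⇒< D j (ℕ.<-trans j<h h<L) present)))))
    (λ (above , below) j 1≤j j≤n → case j <? h of λ where
       (yes j<h) → Equivalence.from (Crossed-window D (ℕ.<⇒≤ j<h))
                                    (below j<h 1≤j (present-< D j (ℕ.<-trans j<h h<L) (s≤s j≤n)))
       (no  j≮h) → above j (ℕ.≮⇒≥ j≮h) (s≤s j≤n))

  Good : ∀ {n} → Vec Bool (suc n) → Set
  Good {n} D = memb 0 D ≡ true × memb n D ≡ true × AllCrossed D n × StartIs m D U × EndIs m D V

  Good⇔ : ∀ {n} (D : Vec Bool (suc n)) → Good D ⇔ (Invariant D × Final (window D))
  Good⇔ D = mk⇔
    (λ (0∈D , n∈D , crossed , start , end) →
       let (above , below) = Equivalence.to (AllCrossed⇔ D) crossed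
           (match , beyond) = Equivalence.to (EndIs⇔ D) end
       in (n∈D , match , above) , trans (bit-window D 0 (s≤s z≤n)) 0∈D , Equivalence.to (StartIs⇔ D) start , beyond , below)
    (λ ((n∈D , match , above) , 0∈W , start , beyond , below) →
       trans (sym (bit-window D 0 (s≤s z≤n))) 0∈W , n∈D , Equivalence.from (AllCrossed⇔ D) (above , below) ,
       Equivalence.from (StartIs⇔ D) start , Equivalence.from (EndIs⇔ D) (match , beyond))

  accept⇔Good : ∀ {n} (D : Vec Bool (suc n)) → T (Automaton.accept automaton (run D)) ⇔ Good D
  accept⇔Good D = ⇔-sym (Good⇔ D) ⇔-∘ ((valid⇔ D ×-⇔ ⇔-id _) ⇔-∘ T-∧-isYes (valid D) (final? (window D)))

Maybe-Bool↔Fin3 : Maybe Bool ↔ Fin 3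
Maybe-Bool↔Fin3 = mk↔ₛ′ to from
  (λ { zero → refl ; (suc zero) → refl ; (suc (suc zero)) → refl })
  (λ { nothing → refl ; (just false) → refl ; (just true) → refl })
  where
  to : Maybe Bool → Fin 3
  to nothing      = zero
  to (just false) = suc zero
  to (just true)  = suc (suc zero)
  from : Fin 3 → Maybe Bool
  from zero          = nothing
  from (suc zero)    = just false
  from (suc (suc _)) = just true

Vec↔Fin^ : ∀ {A : Set} {k} → A ↔ Fin k → ∀ L → Vec A L ↔ Fin (k ^ L)
Vec↔Fin^ A↔Fin zero    = mk↔ₛ′ (λ _ → zero) (λ _ → []) (λ { zero → refl ; (suc ()) }) (λ { [] → refl })
Vec↔Fin^ A↔Fin (suc L) = ↔-trans (mk↔ₛ′ uncons (uncurry _∷_) (λ _ → refl) (λ { (_ ∷ _) → refl }))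
                                 (↔-trans (A↔Fin ×-↔ Vec↔Fin^ A↔Fin L) (↔-sym *↔×))

module ShadowSeries (S : List ℤ) (m : ℕ) (U V : ℕ → Bool)
                    (S-sym : SymmetricSet S) (S-closed : ComplClosed S) (S-max : IsMax S m) where
  open WindowAutomaton S m U V
  open Crossing.Characterisation S m S-sym S-closed S-max using (isShadow⇔)

  stateEncoding : (Bool × Window) ↔ Fin (2 ℕ.* 3 ^ L)
  stateEncoding = ↔-trans (↔-sym 2↔Bool ×-↔ Vec↔Fin^ Maybe-Bool↔Fin3 L) (↔-sym (*↔× {2} {3 ^ L}))

  module _ {N} (encoding : (Bool × Window) ↔ Fin N) where
    open Automaton (encode encoding automaton) using (run; accept; acceptedCount)

    shadow⇔accepted : ∀ k {n} (D : Vec Bool (suc n)) →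
      (IsShadow S D × StartIs m D U × EndIs m D V × card D ≡ k) ⇔ T ((card D ≡ᵇ k) ∧ accept (run D))
    shadow⇔accepted k D = mk⇔
      (λ (shadow , start , end , card≡k) →
         let (0∈D , n∈D , crossed) = Equivalence.to (isShadow⇔ D) shadow
         in Equivalence.from (Bool.T-∧ {card D ≡ᵇ k} {accept (run D)}) (ℕ.≡⇒≡ᵇ (card D) k card≡k ,
              subst T (sym (accept-encode encoding automaton D))
                (Equivalence.from (accept⇔Good D) (0∈D , n∈D , crossed , start , end))))
      (λ t → let (card≡k , accepted) = Equivalence.to (Bool.T-∧ {card D ≡ᵇ k} {accept (run D)}) t
                 (0∈D , n∈D , crossed , start , end) = Equivalence.to (accept⇔Good D)
                    (subst T (accept-encode encoding automaton D) accepted)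
             in Equivalence.from (isShadow⇔ D) (0∈D , n∈D , crossed) , start , end , ℕ.≡ᵇ⇒≡ (card D) k card≡k)

    shadows-↔ : ∀ k n → Fin (acceptedCount k n) ↔ ShadowsUV S m U V k n
    shadows-↔ k n = ↔-trans (count-↔ (suc n) _)
      (Refinement-cong (λ D → Equivalence.from (shadow⇔accepted k D)) (λ D → Equivalence.to (shadow⇔accepted k D)))

    series-rational : Σ (Poly₂ × Poly₂) λ (P , Q) → SeriesIsRational S m U V P Q
    series-rational = let ((P , Q) , expansion) = TransferMatrix.acceptedCount-rational (encode encoding automaton)
                      in (P , Q) , acceptedCount , shadows-↔ , expansion

lemma5p12 : (S : List ℤ) (m : ℕ) → SymmetricSet S → ComplClosed S → IsMax S m →
            (U V : ℕ → Bool) → SubsetRange m U → SubsetRange m V →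
            Σ (Poly₂ × Poly₂) λ PQ → SeriesIsRational S m U V (proj₁ PQ) (proj₂ PQ)
-- U and V are only consulted on [1;m-1].
lemma5p12 S m S-sym S-closed S-max U V _ _ = series-rational stateEncoding
  where open ShadowSeries S m U V S-sym S-closed S-max
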